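{- If $\sigma\in\mathfrak{S}_n^{\nearrow}(132)$, then $f=\phi^{ -1}(\sigma)\in V_n$, i.e. there exists $k$ with $1\le k\le n$ such that $f_1=f_2=\cdots=f_k=1<f_{k+1}<f_{k+2}<\cdots<f_n$.
   Context: $[n]=\{1,\dots,n\}$, $\mathfrak{S}_n$ the symmetric group on $[n]$; products of permutations are composed with the leftmost factor acting first: $(\alpha\beta)(x)=\beta(\alpha(x))$. A function $f:[n]\to[n]$ is subexceedant if $1\le f(i)\le i$ for all $i$, written $f_1\cdots f_n$; $F_n$ is the set of such functions. $\phi:F_n\to\mathfrak{S}_n$, $\phi(f)=(1,f_1)(2,f_2)\cdots(n,f_n)$ (with $(i,i)$ the identity), is a bijection. $F_n^{\nearrow}$ is the set of non-decreasing subexceedant functions on $[n]$ and $\mathfrak{S}_n^{\nearrow}=\phi(F_n^{\nearrow})$. A permutation $\sigma$ contains a pattern $\pi\in\mathfrak{S}_3$ if there are $a<b<c$ with $\sigma(a)\sigma(b)\sigma(c)$ in the same relative order as $\pi(1)\pi(2)\pi(3)$; $\mathfrak{S}_n^{\nearrow}(\pi)$ is the set of $\sigma\in\mathfrak{S}_n^{\nearrow}$ not containing $\pi$. $V_n$ is the set of $f\in F_n^{\nearrow}$ such that $f_1=\cdots=f_k=1<f_{k+1}<\cdots<f_n$ for some $1\le k\le n$. -}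

module Defs where

open import Data.Nat using (ℕ; zero; suc; _+_; _≤_; _<_; _≟_)
open import Data.Fin using (Fin; toℕ)
open import Data.Product using (Σ; _×_; _,_; ∃-syntax)
open import Data.List using (List; []; _∷_; tabulate)
open import Relation.Nullary using (¬_; yes; no)
open import Relation.Binary.PropositionalEquality using (_≡_)

-- A function f : [n] → [n] is encoded as  f : Fin n → ℕ , where the
-- argument  i : Fin n  stands for the position  toℕ i + 1  ∈ [n]
-- and the value is f_{toℕ i + 1} (values are the 1-based integers of [n]).

Subexceedant : {n : ℕ} → (Fin n → ℕ) → Set
Subexceedant {n} f = (i : Fin n) → (1 ≤ f i) × (f i ≤ suc (toℕ i))

NonDecreasing : {n : ℕ} → (Fin n → ℕ) → Set
NonDecreasing {n} f = (i j : Fin n) → toℕ i ≤ toℕ j → f i ≤ f j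

transp : ℕ → ℕ → ℕ → ℕ
transp a b x with x ≟ a
... | yes _ = b
... | no _ with x ≟ b
...   | yes _ = a
...   | no _ = x

-- Product of transpositions, leftmost factor acting first:
-- applyAll [(a₁,b₁), …, (a_m,b_m)] x = (a_m,b_m)( … (a₁,b₁)(x) … ).
applyAll : List (ℕ × ℕ) → ℕ → ℕ
applyAll [] x = x
applyAll ((a , b) ∷ ts) x = applyAll ts (transp a b x)

-- φ(f) = (1,f_1)(2,f_2)⋯(n,f_n), as a map ℕ → ℕ (restricted to [n] it is
-- the permutation φ(f) ∈ 𝔖_n; it fixes every x outside [n]).
phi : (n : ℕ) → (Fin n → ℕ) → ℕ → ℕ
phi n f = applyAll (tabulate {n = n} (λ i → (suc (toℕ i) , f i)))

Contains132 : (n : ℕ) → (ℕ → ℕ) → Set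
Contains132 n σ = ∃[ a ] ∃[ b ] ∃[ c ]
  ((1 ≤ a) × (a < b) × (b < c) × (c ≤ n) × (σ a < σ c) × (σ c < σ b))

Avoids132 : (n : ℕ) → (ℕ → ℕ) → Set
Avoids132 n σ = ¬ Contains132 n σ

-- f ∈ V_n: there is k with 1 ≤ k ≤ n such that
-- f_1 = ⋯ = f_k = 1 < f_{k+1} < f_{k+2} < ⋯ < f_n.
-- (Position toℕ i + 1 ≤ k  iff  toℕ i < k.)
InV : {n : ℕ} → (Fin n → ℕ) → Set
InV {n} f = ∃[ k ] ((1 ≤ k) × (k ≤ n)
  × ((i : Fin n) → toℕ i < k → f i ≡ 1)
  × ((i : Fin n) → k ≤ toℕ i → 1 < f i)
  × ((i j : Fin n) → k ≤ toℕ i → toℕ i < toℕ j → f i < f j))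

{-# OPTIONS --safe #-}
module Submission where

open import Defs
open import Data.Nat using (ℕ; zero; suc; _+_; _≤_; _<_; _≟_; _<?_; _≤?_; z≤n; s≤s; z<s; s<s; s<s⁻¹)
open import Data.Nat.Properties
open import Data.Fin using (Fin; toℕ; fromℕ<)
open import Data.Fin.Properties using (toℕ<n; fromℕ<-toℕ; toℕ-fromℕ<)
open import Data.Product using (_×_; _,_; ∃-syntax; proj₁; proj₂)
open import Data.Sum using (_⊎_; inj₁; inj₂)
open import Data.List using (List; []; _∷_; _++_; tabulate)
open import Data.List.Properties using (tabulate-cong)
open import Data.List.Relation.Unary.All using (All; []; _∷_)
open import Data.Empty using (⊥-elim)
open import Function using (_∘_)
open import Relation.Nullary using (¬_; Dec; yes; no; contradiction)
open import Relation.Nullary.Decidable using (_×-dec_)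
open import Relation.Unary using (Decidable)
open import Relation.Binary.PropositionalEquality

-- Take the last m with f_{m+1} = f_{m+2} = v ≥ 2, so that f exceeds v beyond position m+2,
-- and write σ = φ(f) = prefix · (m+1, v) · (m+2, v) · suffix. The prefix permutes [1, m],
-- the suffix fixes [1, v] and preserves (v, ∞), and the middle factors send m+1 ↦ m+2 and
-- m+2 ↦ v. Hence σ(a) = 1 < σ(m+2) = v < σ(m+1) for the a ≤ m with prefix(a) = 1, a 132
-- pattern. So f repeats no value ≥ 2 and, being non-decreasing with f_1 = 1, lies in V_n.

longestPrefix : {P : ℕ → Set} → Decidable P → ∀ N →
  ∃[ k ] k ≤ N × (∀ {i} → i < k → P i) × (k < N → ¬ P k)
longestPrefix P? zero = 0 , z≤n , (λ ()) , (λ ())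
longestPrefix P? (suc N) with P? 0
... | no ¬p = 0 , z≤n , (λ ()) , (λ _ → ¬p)
... | yes p with longestPrefix (P? ∘ suc) N
...   | k , k≤N , prefix , stop =
  suc k , s≤s k≤N , (λ { {zero} _ → p ; {suc i} i<k → prefix (s<s⁻¹ i<k) }) , stop ∘ s<s⁻¹

lastBelow : {P : ℕ → Set} → Decidable P → ∀ N →
  (∀ {i} → i < N → ¬ P i) ⊎ ∃[ m ] m < N × P m × (∀ {i} → m < i → i < N → ¬ P i)
lastBelow P? zero = inj₁ (λ ())
lastBelow P? (suc N) with lastBelow (P? ∘ suc) N
... | inj₂ (m , m<N , p , after) =
  inj₂ (suc m , s<s m<N , p , λ { {suc i} m<i i<N → after (s<s⁻¹ m<i) (s<s⁻¹ i<N) })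
... | inj₁ none with P? 0
...   | yes p = inj₂ (0 , z<s , p , λ { {suc i} _ i<N → none (s<s⁻¹ i<N) })
...   | no ¬p = inj₁ (λ { {zero} _ → ¬p ; {suc i} i<N → none (s<s⁻¹ i<N) })

transp-left : ∀ a b → transp a b a ≡ b
transp-left a b with a ≟ a
... | yes _ = refl
... | no a≢a = contradiction refl a≢a

transp-right : ∀ a b → transp a b b ≡ a
transp-right a b with b ≟ a
... | yes b≡a = b≡a
... | no _ with b ≟ b
...   | yes _ = refl
...   | no b≢b = contradiction refl b≢b

transp-other : ∀ {a b x} → x ≢ a → x ≢ b → transp a b x ≡ x
transp-other {a} {b} {x} x≢a x≢b with x ≟ a
... | yes x≡a = contradiction x≡a x≢a
... | no _ with x ≟ b
...   | yes x≡b = contradiction x≡b x≢b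
...   | no _ = refl

transp-preserves : (P : ℕ → Set) → ∀ {a b x} → P a → P b → P x → P (transp a b x)
transp-preserves P {a} {b} {x} pa pb px with x ≟ a
... | yes _ = pb
... | no _ with x ≟ b
...   | yes _ = pa
...   | no _ = px

transp-involutive : ∀ a b x → transp a b (transp a b x) ≡ x
transp-involutive a b x = by-cases (x ≟ a) (x ≟ b)
  where
    by-cases : Dec (x ≡ a) → Dec (x ≡ b) → transp a b (transp a b x) ≡ x
    by-cases (yes refl) _ = trans (cong (transp x b) (transp-left x b)) (transp-right x b)
    by-cases (no _) (yes refl) = trans (cong (transp a x) (transp-right a x)) (transp-left a x)
    by-cases (no x≢a) (no x≢b) =
      trans (cong (transp a b) (transp-other x≢a x≢b)) (transp-other x≢a x≢b)

Within : (ℕ → Set) → ℕ × ℕ → Set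
Within P (a , b) = P a × P b

applyAll-++ : ∀ ts us x → applyAll (ts ++ us) x ≡ applyAll us (applyAll ts x)
applyAll-++ [] us x = refl
applyAll-++ ((a , b) ∷ ts) us x = applyAll-++ ts us (transp a b x)

applyAll-preserves : ∀ {P ts x} → All (Within P) ts → P x → P (applyAll ts x)
applyAll-preserves [] px = px
applyAll-preserves {P} ((pa , pb) ∷ ts⊆P) px = applyAll-preserves ts⊆P (transp-preserves P pa pb px)

applyAll-fixes : ∀ {P ts x} → All (Within P) ts → ¬ P x → applyAll ts x ≡ x
applyAll-fixes [] _ = refl
applyAll-fixes {P} {(a , b) ∷ ts} ((pa , pb) ∷ ts⊆P) ¬px =
  trans (cong (applyAll ts) (transp-other (λ { refl → ¬px pa }) (λ { refl → ¬px pb })))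
        (applyAll-fixes ts⊆P ¬px)

applyAll-onto : ∀ {P ts y} → All (Within P) ts → P y → ∃[ x ] P x × applyAll ts x ≡ y
applyAll-onto [] py = _ , py , refl
applyAll-onto {P} {(a , b) ∷ ts} ((pa , pb) ∷ ts⊆P) py with applyAll-onto ts⊆P py
... | x , px , x↦y =
  transp a b x , transp-preserves P pa pb px ,
  trans (cong (applyAll ts) (transp-involutive a b x)) x↦y

plateau-contains132 : ∀ {n b v} pre suf → 2 ≤ v → v ≤ b → suc b ≤ n →
  All (Within (λ y → 1 ≤ y × y < b)) pre → All (Within (v <_)) suf →
  Contains132 n (applyAll (pre ++ (b , v) ∷ (suc b , v) ∷ suf))
plateau-contains132 {n} {b} {v} pre suf 2≤v v≤b b<n pre<b suf>v =
  a , b , suc b , 1≤a , a<b , ≤-refl , b<n ,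
  subst₂ _<_ (sym σa≡1) (sym σc≡v) 2≤v , subst (_< σ b) (sym σc≡v) v<σb
  where
    σ = applyAll (pre ++ (b , v) ∷ (suc b , v) ∷ suf)
    open ≡-Reasoning

    1<b : 1 < b
    1<b = ≤-trans 2≤v v≤b

    σ-split : ∀ y → σ y ≡ applyAll suf (transp (suc b) v (transp b v (applyAll pre y)))
    σ-split = applyAll-++ pre ((b , v) ∷ (suc b , v) ∷ suf)

    pre-fixes : ∀ {y} → b ≤ y → applyAll pre y ≡ y
    pre-fixes b≤y = applyAll-fixes pre<b (λ (_ , y<b) → <⇒≱ y<b b≤y)

    suf-fixes : ∀ {y} → y ≤ v → applyAll suf y ≡ y
    suf-fixes y≤v = applyAll-fixes suf>v (≤⇒≯ y≤v)

    preimage-of-1 = applyAll-onto pre<b (≤-refl , 1<b)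
    a = proj₁ preimage-of-1
    1≤a = proj₁ (proj₁ (proj₂ preimage-of-1))
    a<b = proj₂ (proj₁ (proj₂ preimage-of-1))
    pre[a]≡1 = proj₂ (proj₂ preimage-of-1)

    σa≡1 : σ a ≡ 1
    σa≡1 = begin
      σ a
        ≡⟨ σ-split a ⟩
      applyAll suf (transp (suc b) v (transp b v (applyAll pre a)))
        ≡⟨ cong (applyAll suf ∘ transp (suc b) v ∘ transp b v) pre[a]≡1 ⟩
      applyAll suf (transp (suc b) v (transp b v 1))
        ≡⟨ cong (applyAll suf ∘ transp (suc b) v) (transp-other (<⇒≢ 1<b) (<⇒≢ 2≤v)) ⟩
      applyAll suf (transp (suc b) v 1)
        ≡⟨ cong (applyAll suf) (transp-other (<⇒≢ (m<n⇒m<1+n 1<b)) (<⇒≢ 2≤v)) ⟩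
      applyAll suf 1
        ≡⟨ suf-fixes (<⇒≤ 2≤v) ⟩
      1 ∎

    σc≡v : σ (suc b) ≡ v
    σc≡v = begin
      σ (suc b)
        ≡⟨ σ-split (suc b) ⟩
      applyAll suf (transp (suc b) v (transp b v (applyAll pre (suc b))))
        ≡⟨ cong (applyAll suf ∘ transp (suc b) v ∘ transp b v) (pre-fixes (n≤1+n b)) ⟩
      applyAll suf (transp (suc b) v (transp b v (suc b)))
        ≡⟨ cong (applyAll suf ∘ transp (suc b) v) (transp-other 1+n≢n (>⇒≢ (s≤s v≤b))) ⟩
      applyAll suf (transp (suc b) v (suc b))
        ≡⟨ cong (applyAll suf) (transp-left (suc b) v) ⟩
      applyAll suf v
        ≡⟨ suf-fixes ≤-refl ⟩
      v ∎

    σb≡suf[c] : σ b ≡ applyAll suf (suc b)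
    σb≡suf[c] = begin
      σ b
        ≡⟨ σ-split b ⟩
      applyAll suf (transp (suc b) v (transp b v (applyAll pre b)))
        ≡⟨ cong (applyAll suf ∘ transp (suc b) v ∘ transp b v) (pre-fixes ≤-refl) ⟩
      applyAll suf (transp (suc b) v (transp b v b))
        ≡⟨ cong (applyAll suf ∘ transp (suc b) v) (transp-left b v) ⟩
      applyAll suf (transp (suc b) v v)
        ≡⟨ cong (applyAll suf) (transp-right (suc b) v) ⟩
      applyAll suf (suc b) ∎

    v<σb : v < σ b
    v<σb = subst (v <_) (sym σb≡suf[c]) (applyAll-preserves suf>v (s≤s v≤b))

-- (s+1, h s) ⋯ (s+k, h (s+k−1)); h i plays the role of f_{i+1}.
transpositions : (ℕ → ℕ) → ℕ → ℕ → List (ℕ × ℕ)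
transpositions h s zero = []
transpositions h s (suc k) = (suc s , h s) ∷ transpositions h (suc s) k

transpositions-++ : ∀ h s k l →
  transpositions h s (k + l) ≡ transpositions h s k ++ transpositions h (s + k) l
transpositions-++ h s zero l rewrite +-identityʳ s = refl
transpositions-++ h s (suc k) l rewrite +-suc s k =
  cong ((suc s , h s) ∷_) (transpositions-++ h (suc s) k l)

transpositions⁺ : ∀ {Q : ℕ × ℕ → Set} {h s k} →
  (∀ {i} → s ≤ i → i < s + k → Q (suc i , h i)) → All Q (transpositions h s k)
transpositions⁺ {k = zero} q = []
transpositions⁺ {s = s} {suc k} q =
  q ≤-refl (m<m+n s z<s) ∷
  transpositions⁺ λ s<i i<s+k → q (<⇒≤ s<i) (subst (_<_ _) (sym (+-suc s k)) i<s+k)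

tabulate≡transpositions : ∀ h s k →
  tabulate {n = k} (λ i → suc (s + toℕ i) , h (s + toℕ i)) ≡ transpositions h s k
tabulate≡transpositions h s zero = refl
tabulate≡transpositions h s (suc k) rewrite +-identityʳ s =
  cong ((suc s , h s) ∷_)
    (trans (tabulate-cong λ i → cong (λ t → suc t , h t) (+-suc s (toℕ i)))
           (tabulate≡transpositions h (suc s) k))

Plateau : ℕ → (ℕ → ℕ) → ℕ → Set
Plateau n h i = suc i < n × h i ≡ h (suc i) × 2 ≤ h i

plateau? : ∀ n h → Decidable (Plateau n h)
plateau? n h i = suc i <? n ×-dec h i ≟ h (suc i) ×-dec 2 ≤? h i

InVℕ : ℕ → (ℕ → ℕ) → Set
InVℕ n h = ∃[ k ] 1 ≤ k × k ≤ n
  × (∀ {i} → i < k → h i ≡ 1)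
  × (∀ {i} → k ≤ i → i < n → 1 < h i)
  × (∀ {i j} → k ≤ i → i < j → j < n → h i < h j)

module _ {n : ℕ} {h : ℕ → ℕ}
  (subexceedant : ∀ {i} → i < n → 1 ≤ h i × h i ≤ suc i)
  (nondecreasing : ∀ {i j} → i ≤ j → j < n → h i ≤ h j) where

  increasing-beyond-plateaus : ∀ {a} → (∀ {i} → a ≤ i → i < n → ¬ Plateau n h i) →
    ∀ {i j} → a ≤ i → i < j → j < n → 2 ≤ h i → h i < h j
  increasing-beyond-plateaus none {i} a≤i i<j j<n 2≤hi =
    <-≤-trans hi<hsi (nondecreasing i<j j<n)
    where
      si<n = ≤-<-trans i<j j<n
      i<n = <-trans (n<1+n i) si<n
      hi<hsi = ≤∧≢⇒< (nondecreasing (n≤1+n i) si<n) λ hi≡hsi → none a≤i i<n (si<n , hi≡hsi , 2≤hi)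

  no-plateau⇒InVℕ : 1 ≤ n → (∀ {i} → i < n → ¬ Plateau n h i) → InVℕ n h
  no-plateau⇒InVℕ 1≤n none with longestPrefix (λ i → h i ≟ 1) n
  ... | zero , _ , _ , stop = contradiction h0≡1 (stop 1≤n)
    where h0≡1 = ≤-antisym (proj₂ (subexceedant 1≤n)) (proj₁ (subexceedant 1≤n))
  ... | suc k , k<n , ones , stop =
    suc k , s≤s z≤n , k<n , ones , above1 ,
    λ k<i i<j j<n → increasing-beyond-plateaus (λ _ → none) z≤n i<j j<n (above1 k<i (<-trans i<j j<n))
    where
      above1 : ∀ {i} → suc k ≤ i → i < n → 1 < h i
      above1 k<i i<n = <-≤-trans (≤∧≢⇒< (proj₁ (subexceedant sk<n)) (≢-sym (stop sk<n))) (nondecreasing k<i i<n)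
        where sk<n = ≤-<-trans k<i i<n

  last-plateau⇒contains132 : ∀ {m} → Plateau n h m → (∀ {i} → m < i → i < n → ¬ Plateau n h i) →
    Contains132 n (applyAll (transpositions h 0 n))
  last-plateau⇒contains132 {m} (sm<n , hm≡hsm , 2≤hm) last =
    subst (Contains132 n ∘ applyAll) (sym split)
      (plateau-contains132 pre suf 2≤hm hm≤sm sm<n pre⊆[1,m] suf>hm)
    where
      open ≡-Reasoning
      r = proj₁ (m≤n⇒∃[o]m+o≡n sm<n)
      ssm+r≡n = proj₂ (m≤n⇒∃[o]m+o≡n sm<n)
      pre = transpositions h 0 m
      suf = transpositions h (suc (suc m)) r
      m<n = <-trans (n<1+n m) sm<n
      hm≤sm = proj₂ (subexceedant m<n)

      m+ssr≡n : m + suc (suc r) ≡ n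
      m+ssr≡n = trans (+-suc m (suc r)) (trans (cong suc (+-suc m r)) ssm+r≡n)

      split : transpositions h 0 n ≡ pre ++ (suc m , h m) ∷ (suc (suc m) , h m) ∷ suf
      split = begin
        transpositions h 0 n
          ≡⟨ cong (transpositions h 0) (sym m+ssr≡n) ⟩
        transpositions h 0 (m + suc (suc r))
          ≡⟨ transpositions-++ h 0 m (suc (suc r)) ⟩
        pre ++ (suc m , h m) ∷ (suc (suc m) , h (suc m)) ∷ suf
          ≡⟨ cong (λ u → pre ++ (suc m , h m) ∷ (suc (suc m) , u) ∷ suf) (sym hm≡hsm) ⟩
        pre ++ (suc m , h m) ∷ (suc (suc m) , h m) ∷ suf ∎

      pre⊆[1,m] : All (Within (λ y → 1 ≤ y × y < suc m)) pre
      pre⊆[1,m] = transpositions⁺ λ _ i<m →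
        let 1≤hi , hi≤si = subexceedant (<-trans i<m m<n)
        in (s≤s z≤n , s≤s i<m) , (1≤hi , s≤s (≤-trans hi≤si i<m))

      suf>hm : All (Within (h m <_)) suf
      suf>hm = transpositions⁺ λ {i} ssm≤i i<n →
        s≤s (≤-trans hm≤sm (<⇒≤ ssm≤i)) ,
        subst (_< h i) (sym hm≡hsm)
          (increasing-beyond-plateaus last ≤-refl ssm≤i (subst (i <_) ssm+r≡n i<n)
            (subst (2 ≤_) hm≡hsm 2≤hm))

  avoids132⇒InVℕ : 1 ≤ n → Avoids132 n (applyAll (transpositions h 0 n)) → InVℕ n h
  avoids132⇒InVℕ 1≤n avoids with lastBelow (plateau? n h) n
  ... | inj₁ none = no-plateau⇒InVℕ 1≤n none
  ... | inj₂ (_ , _ , plateau , last) = ⊥-elim (avoids (last-plateau⇒contains132 plateau last))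

extend : ∀ {n} → (Fin n → ℕ) → ℕ → ℕ
extend {n} f i with i <? n
... | yes i<n = f (fromℕ< i<n)
... | no _ = 0

module _ {n : ℕ} (f : Fin n → ℕ) where

  extend-toℕ : ∀ i → extend f (toℕ i) ≡ f i
  extend-toℕ i with toℕ i <? n
  ... | yes i<n = cong f (fromℕ<-toℕ i i<n)
  ... | no i≮n = contradiction (toℕ<n i) i≮n

  extend-fromℕ< : ∀ {i} (i<n : i < n) → extend f i ≡ f (fromℕ< i<n)
  extend-fromℕ< i<n = trans (cong (extend f) (sym (toℕ-fromℕ< i<n))) (extend-toℕ (fromℕ< i<n))

  extend-subexceedant : Subexceedant f → ∀ {i} → i < n → 1 ≤ extend f i × extend f i ≤ suc i
  extend-subexceedant sub i<n rewrite extend-fromℕ< i<n =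
    let 1≤fi , fi≤si = sub (fromℕ< i<n)
    in 1≤fi , subst (λ t → f (fromℕ< i<n) ≤ suc t) (toℕ-fromℕ< i<n) fi≤si

  extend-nondecreasing : NonDecreasing f → ∀ {i j} → i ≤ j → j < n → extend f i ≤ extend f j
  extend-nondecreasing nd i≤j j<n rewrite extend-fromℕ< (≤-<-trans i≤j j<n) | extend-fromℕ< j<n =
    nd _ _ (subst₂ _≤_ (sym (toℕ-fromℕ< _)) (sym (toℕ-fromℕ< j<n)) i≤j)

  phi≡transpositions : phi n f ≡ applyAll (transpositions (extend f) 0 n)
  phi≡transpositions = cong applyAll (trans
    (tabulate-cong λ i → cong (suc (toℕ i) ,_) (sym (extend-toℕ i)))
    (tabulate≡transpositions (extend f) 0 n))

  InVℕ⇒InV : InVℕ n (extend f) → InV f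
  InVℕ⇒InV (k , 1≤k , k≤n , ones , above1 , increasing) =
    k , 1≤k , k≤n ,
    (λ i i<k → trans (sym (extend-toℕ i)) (ones i<k)) ,
    (λ i k≤i → subst (1 <_) (extend-toℕ i) (above1 k≤i (toℕ<n i))) ,
    (λ i j k≤i i<j → subst₂ _<_ (extend-toℕ i) (extend-toℕ j) (increasing k≤i i<j (toℕ<n j)))

proposition5p2 : (n : ℕ) → 1 ≤ n → (f : Fin n → ℕ) →
    Subexceedant f → NonDecreasing f → Avoids132 n (phi n f) → InV f
proposition5p2 n 1≤n f sub nd avoids =
  InVℕ⇒InV f (avoids132⇒InVℕ (extend-subexceedant f sub) (extend-nondecreasing f nd) 1≤n
    (subst (Avoids132 n) (phi≡transpositions f) avoids))
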